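{- Let $G$ be a hypergraph and $\mathcal{T}=(T,\mathcal{L})$ a $k$-good rooted superbranch decomposition of $G$. Then $\mathrm{depth}(T)\le2^{\mathcal{O}(k)}\log\|G\|$.
   Context: Hypergraphs: a hypergraph $G$ has finite vertex set $V(G)$, finite hyperedge set $E(G)$ and sets $V(e)\subseteq V(G)$ for $e\in E(G)$, with $V(G)=\bigcup_e V(e)$; $\|G\|=|V(G)|+\sum_e(|V(e)|+1)$. For $A\subseteq E(G)$: $\mathrm{bd}(A)=V(A)\cap V(E(G)\setminus A)$ where $V(A)=\bigcup_{e\in A}V(e)$, and $\lambda(A)=|\mathrm{bd}(A)|$; $A$ is well-linked if every bipartition $(C_1,C_2)$ of $A$ has $\lambda(C_1)\ge\lambda(A)$ or $\lambda(C_2)\ge\lambda(A)$. A rooted superbranch decomposition of $G$ is a pair $(T,\mathcal{L})$ where $T$ is a rooted tree whose non-leaf nodes have degree $\ge3$ (leaves: degree $\le1$; the root may be a leaf) and $\mathcal{L}$ is a bijection from leaves to $E(G)$; $\mathcal{L}[t]$ denotes the set of hyperedges mapped to leaf descendants of $t$, depth is distance from the root, and $\mathrm{depth}(T)$ is the maximum depth. It is downwards well-linked if each $\mathcal{L}[t]$ is well-linked in $G$. It is $k$-semigood if it is downwards well-linked and every node has at most $2^{2k}+1$ children. A node $t$ is $d$-unbalanced if it has a descendant $s$ with $\mathrm{depth}(s)\ge\mathrm{depth}(t)+d$ and $|\mathcal{L}[s]|\ge\frac23|\mathcal{L}[t]|$, and $d$-balanced otherwise. It is $k$-good if it is $k$-semigood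 and all non-root nodes are $2^{2k+1}$-balanced. -}

module Defs where

open import Data.Nat using (ℕ; zero; suc; _+_; _*_; _^_; _≤_; _<_; _⊔_)
open import Data.Bool using (Bool; true; false; _∧_; not)
open import Data.Fin using (Fin; zero; suc)
open import Data.Fin.Properties using () renaming (_≟_ to _≟ᶠ_)
open import Data.Fin.Subset using (Subset; ∣_∣)
open import Data.Vec using (tabulate)
open import Data.List using (List; []; _∷_; length; _++_; allFin)
import Data.List.Membership.DecPropositional as DecMem
open import Data.List.Membership.Propositional using (_∈_)
open import Data.List.Relation.Binary.Permutation.Propositional using (_↭_)
open import Data.Maybe using (Maybe; just; nothing)
open import Data.Product using (Σ; ∃; _×_; _,_)
open import Data.Sum using (_⊎_)
open import Relation.Nullary using (¬_)
open import Relation.Nullary.Decidable using (⌊_⌋)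
open import Relation.Binary.PropositionalEquality using (_≡_)

anyF : ∀ n → (Fin n → Bool) → Bool
anyF zero    f = false
anyF (suc n) f = Data.Bool._∨_ (f zero) (anyF n (λ i → f (suc i)))

sumF : ∀ n → (Fin n → ℕ) → ℕ
sumF zero    f = 0
sumF (suc n) f = f zero + sumF n (λ i → f (suc i))

-- Hypergraphs: vertices Fin nV, hyperedges Fin nE, incidence inc e v
-- (v ∈ V(e)); every vertex lies in some hyperedge (V(G) = ⋃ V(e)).

record Hypergraph : Set where
  field
    nV     : ℕ
    nE     : ℕ
    inc    : Fin nE → Fin nV → Bool
    covers : ∀ v → ∃ λ e → inc e v ≡ true
open Hypergraph public

Ve : (G : Hypergraph) → Fin (nE G) → Subset (nV G)
Ve G e = tabulate (inc G e)

size : Hypergraph → ℕ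
size G = nV G + sumF (nE G) (λ e → ∣ Ve G e ∣ + 1)

EdgeSet : Hypergraph → Set
EdgeSet G = Subset (nE G)

bd : (G : Hypergraph) → EdgeSet G → Subset (nV G)
bd G A = tabulate λ v →
  anyF (nE G) (λ e → Data.Vec.lookup A e ∧ inc G e v)
  ∧ anyF (nE G) (λ e → not (Data.Vec.lookup A e) ∧ inc G e v)

λ′ : (G : Hypergraph) → EdgeSet G → ℕ
λ′ G A = ∣ bd G A ∣

IsBipartition : (G : Hypergraph) → EdgeSet G → EdgeSet G → EdgeSet G → Set
IsBipartition G A C₁ C₂ = ∀ e →
  (Data.Vec.lookup C₁ e ∧ Data.Vec.lookup C₂ e ≡ false)
  × (Data.Bool._∨_ (Data.Vec.lookup C₁ e) (Data.Vec.lookup C₂ e) ≡ Data.Vec.lookup A e)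

WellLinked : (G : Hypergraph) → EdgeSet G → Set
WellLinked G A = ∀ C₁ C₂ → IsBipartition G A C₁ C₂ →
  (λ′ G A ≤ λ′ G C₁) ⊎ (λ′ G A ≤ λ′ G C₂)

-- Rooted trees whose nodes may carry a hyperedge label (labels are put
-- exactly on the leaves, see RootOK / NonRootOK below).

data RTree (m : ℕ) : Set where
  nd : Maybe (Fin m) → List (RTree m) → RTree m

children : ∀ {m} → RTree m → List (RTree m)
children (nd _ cs) = cs

label : ∀ {m} → RTree m → Maybe (Fin m)
label (nd l _) = l

mutual
  labels : ∀ {m} → RTree m → List (Fin m)
  labels (nd nothing  cs) = labelsL cs
  labels (nd (just e) cs) = e ∷ labelsL cs

  labelsL : ∀ {m} → List (RTree m) → List (Fin m)
  labelsL []       = []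
  labelsL (t ∷ ts) = labels t ++ labelsL ts

mutual
  height : ∀ {m} → RTree m → ℕ
  height (nd _ []) = 0
  height (nd _ (c ∷ cs)) = suc (heightL (c ∷ cs))

  heightL : ∀ {m} → List (RTree m) → ℕ
  heightL []       = 0
  heightL (t ∷ ts) = height t ⊔ heightL ts

data Desc {m : ℕ} : ℕ → RTree m → RTree m → Set where
  here  : ∀ {t} → Desc 0 t t
  there : ∀ {d t c s} → c ∈ children t → Desc d c s → Desc (suc d) t s

Lset : ∀ {m} → RTree m → Subset m
Lset {m} t = tabulate λ e → ⌊ e ∈? labels t ⌋
  where open DecMem (_≟ᶠ_ {m}) using (_∈?_)

-- degree of the root = #children; degree of a non-root node = #children + 1.
-- Leaves (degree ≤ 1) carry a label, non-leaves have degree ≥ 3 and no label.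
RootOK : ∀ {m} → RTree m → Set
RootOK (nd l cs) = (length cs ≤ 1 × ∃ λ e → l ≡ just e) ⊎ (3 ≤ length cs × l ≡ nothing)

NonRootOK : ∀ {m} → RTree m → Set
NonRootOK (nd l cs) = (length cs ≡ 0 × ∃ λ e → l ≡ just e) ⊎ (2 ≤ length cs × l ≡ nothing)

-- rooted superbranch decomposition: tree shape + bijection leaves → E(G)
IsRSBD : (G : Hypergraph) → RTree (nE G) → Set
IsRSBD G T = RootOK T
  × (∀ d t → Desc (suc d) T t → NonRootOK t)
  × (labels T ↭ allFin (nE G))

DownWL : (G : Hypergraph) → RTree (nE G) → Set
DownWL G T = ∀ d t → Desc d T t → WellLinked G (Lset t)

SemiGood : (G : Hypergraph) → ℕ → RTree (nE G) → Set
SemiGood G k T = DownWL G T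
  × (∀ d t → Desc d T t → length (children t) ≤ 2 ^ (2 * k) + 1)

Unbalanced : ∀ {m} → ℕ → RTree m → Set
Unbalanced D t = Σ ℕ λ d → Σ _ λ s → D ≤ d × Desc d t s × 2 * ∣ Lset t ∣ ≤ 3 * ∣ Lset s ∣

Good : (G : Hypergraph) → ℕ → RTree (nE G) → Set
Good G k T = SemiGood G k T
  × (∀ d t → Desc (suc d) T t → ¬ Unbalanced (2 ^ (2 * k + 1)) t)

-- Every non-root node u is D-balanced for D = 2^(2k+1): D levels below u fewer than 2/3 of
-- the hyperedges of 𝓛[u] remain, so 2D levels below u fewer than 4/9 remain, which halves
-- 1 + |𝓛|. Below a child of the root 1 + |𝓛| ≤ 2‖G‖, so a path makes at most log₂ ‖G‖ + 1
-- such double steps and depth ≤ 2D (log₂ ‖G‖ + 2) ≤ 3 · 2D · log₂ ‖G‖; the last step uses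
-- log₂ ‖G‖ ≥ 1, which holds as soon as the root has a child, since G then has two hyperedges.
module Submission where

open import Defs
open import Data.Nat using (ℕ; _+_; _*_; _^_; _≤_)
open import Data.Nat.Logarithm using (⌊log₂_⌋)
open import Data.Product using (Σ)

open import Data.Nat using (zero; suc; _<_; z≤n; s≤s; NonZero; >-nonZero)
open import Data.Nat.Properties
open import Data.Nat.Logarithm using (⌊log₂⌋-mono-≤; ⌊log₂[2*b]⌋≡1+⌊log₂b⌋; ⌊log₂[2^n]⌋≡n)
open import Data.Nat.Tactic.RingSolver using (solve-∀)
open import Algebra.Properties.CommutativeSemigroup *-commutativeSemigroup using (x∙yz≈y∙xz; xy∙z≈xz∙y)
open import Data.Product using (∃; _×_; _,_; proj₂)
open import Data.Sum using (inj₁; inj₂)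
open import Data.Maybe using (just; nothing)
open import Data.List using (List; []; _∷_; length; _++_)
open import Data.List.Properties using (length-++; length-tabulate)
open import Data.List.Relation.Unary.Any using (here; there)
open import Data.List.Membership.Propositional using (_∈_)
open import Data.List.Relation.Binary.Permutation.Propositional.Properties using (↭-length)
open import Data.Fin using (Fin)
open import Data.Fin.Subset using (∣_∣)
open import Data.Fin.Subset.Properties using (∣p∣≤n)
open import Relation.Nullary using (¬_)
open import Relation.Binary.PropositionalEquality using (_≡_; refl; sym; trans; cong; subst)

private
  variable
    m a b h : ℕ
    t u v w s c : RTree m

desc-trans : Desc a t w → Desc b w s → Desc (a + b) t s
desc-trans here        q = q
desc-trans (there c∈ p) q = there c∈ (desc-trans p q)

desc-split : ∀ a → Desc (a + b) t s → ∃ λ w → Desc a t w × Desc b w s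
desc-split zero    p            = _ , here , p
desc-split (suc a) (there c∈ p) = let w , p₁ , p₂ = desc-split a p in w , there c∈ p₁ , p₂

desc-truncate : a ≤ b → Desc b t s → ∃ λ w → Desc a t w
desc-truncate z≤n       _            = _ , here
desc-truncate (s≤s a≤b) (there c∈ p) = let w , q = desc-truncate a≤b p in w , there c∈ q

mutual
  deepest : (t : RTree m) → ∃ λ s → Desc (height t) t s
  deepest (nd _ [])       = _ , here
  deepest (nd _ (c ∷ cs)) = let c′ , c′∈ , s , p = deepestL c cs in s , there c′∈ p

  deepestL : (c : RTree m) (cs : List (RTree m)) →
             ∃ λ c′ → c′ ∈ c ∷ cs × ∃ λ s → Desc (heightL (c ∷ cs)) c′ s
  deepestL c [] = let s , p = deepest c in
    c , here refl , s , subst (λ h → Desc h c s) (sym (⊔-identityʳ (height c))) p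
  deepestL c cs@(c₂ ∷ cs′) with ⊔-sel (height c) (heightL cs)
  ... | inj₁ eq = let s , p = deepest c in
    c , here refl , s , subst (λ h → Desc h c s) (sym eq) p
  ... | inj₂ eq = let c′ , c′∈ , s , p = deepestL c₂ cs′ in
    c′ , there c′∈ , s , subst (λ h → Desc h c′ s) (sym eq) p

Everywhere : (RTree m → Set) → RTree m → Set
Everywhere P t = ∀ d s → Desc d t s → P s

EverywhereBelow : (RTree m → Set) → RTree m → Set
EverywhereBelow P t = ∀ d s → Desc (suc d) t s → P s

Everywhere-desc : ∀ {P : RTree m → Set} → Everywhere P t → Desc a t u → Everywhere P u
Everywhere-desc everywhere p d s q = everywhere _ s (desc-trans p q)

Everywhere-children : ∀ {P : RTree m → Set} → EverywhereBelow P t →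
                      c ∈ children t → Everywhere P c
Everywhere-children below c∈ d s p = below d s (there c∈ p)

mutual
  labels-nonempty : (t : RTree m) → Everywhere NonRootOK t → 1 ≤ length (labels t)
  labels-nonempty (nd (just _) _)  _ = s≤s z≤n
  labels-nonempty (nd nothing  cs) ok with ok 0 _ here
  ... | inj₁ (_ , _ , ())
  ... | inj₂ (2≤|cs| , _) =
    ≤-trans (<⇒≤ 2≤|cs|) (length≤length-labelsL cs (Everywhere-children (λ d → ok (suc d))))

  length≤length-labelsL : (cs : List (RTree m)) → (∀ {c} → c ∈ cs → Everywhere NonRootOK c) →
                          length cs ≤ length (labelsL cs)
  length≤length-labelsL []       _  = z≤n
  length≤length-labelsL (c ∷ cs) ok = begin
    1 + length cs                           ≤⟨ +-mono-≤ (labels-nonempty c (ok (here refl)))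
                                                        (length≤length-labelsL cs (λ c∈ → ok (there c∈))) ⟩
    length (labels c) + length (labelsL cs) ≡⟨ length-++ (labels c) ⟨
    length (labels c ++ labelsL cs)         ∎
    where open ≤-Reasoning

root-child⇒2≤length-labels : (t : RTree m) → RootOK t → EverywhereBelow NonRootOK t →
                             c ∈ children t → 2 ≤ length (labels t)
root-child⇒2≤length-labels (nd (just _) cs@(_ ∷ _)) _ below _ =
  s≤s (≤-trans (s≤s z≤n) (length≤length-labelsL cs (Everywhere-children below)))
root-child⇒2≤length-labels (nd nothing cs) (inj₁ (_ , _ , ())) _ _
root-child⇒2≤length-labels (nd nothing cs) (inj₂ (3≤|cs| , _)) below _ =
  ≤-trans (<⇒≤ 3≤|cs|) (length≤length-labelsL cs (Everywhere-children below))

root-child⇒2≤nE : ∀ {G T} {c : RTree (nE G)} → IsRSBD G T → c ∈ children T → 2 ≤ nE G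
root-child⇒2≤nE {T = T} (root , below , perm) c∈ =
  subst (2 ≤_) (trans (↭-length perm) (length-tabulate (λ e → e)))
        (root-child⇒2≤length-labels T root below c∈)

sumF≥n : ∀ n (f : Fin n → ℕ) → (∀ i → 1 ≤ f i) → n ≤ sumF n f
sumF≥n zero    f pos = z≤n
sumF≥n (suc n) f pos = +-mono-≤ (pos Fin.zero) (sumF≥n n (λ i → f (Fin.suc i)) (λ i → pos (Fin.suc i)))

edges≤size : ∀ G → nE G ≤ size G
edges≤size G = ≤-trans (sumF≥n (nE G) _ (λ e → m≤n+m 1 _)) (m≤n+m _ (nV G))

2^n≤m⇒n≤⌊log₂m⌋ : ∀ {n m} → 2 ^ n ≤ m → n ≤ ⌊log₂ m ⌋
2^n≤m⇒n≤⌊log₂m⌋ {n} le = subst (_≤ _) (⌊log₂[2^n]⌋≡n n) (⌊log₂⌋-mono-≤ le)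

3x<2y⇒3y<2z⇒2x<z : ∀ x y z → 3 * x < 2 * y → 3 * y < 2 * z → 2 * x < z
3x<2y⇒3y<2z⇒2x<z x y z 3x<2y 3y<2z = *-cancelˡ-< 4 (2 * x) z (begin-strict
  4 * (2 * x) ≡⟨ *-assoc 4 2 x ⟨
  8 * x       ≤⟨ m≤n+m (8 * x) x ⟩
  9 * x       ≡⟨ *-assoc 3 3 x ⟩
  3 * (3 * x) <⟨ *-monoʳ-< 3 3x<2y ⟩
  3 * (2 * y) ≡⟨ x∙yz≈y∙xz 3 2 y ⟩
  2 * (3 * y) <⟨ *-monoʳ-< 2 3y<2z ⟩
  2 * (2 * z) ≡⟨ *-assoc 2 2 z ⟨
  4 * z       ∎)
  where open ≤-Reasoning

Balanced : ℕ → RTree m → Set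
Balanced D t = ¬ Unbalanced D t

module _ {D : ℕ} where

  shrinks : Balanced D u → Desc D u w → 3 * ∣ Lset w ∣ < 2 * ∣ Lset u ∣
  shrinks bal p = ≰⇒> λ 2u≤3w → bal (_ , _ , ≤-refl , p , 2u≤3w)

  halves : Everywhere (Balanced D) u → Desc (D + D) u w → 2 * suc ∣ Lset w ∣ ≤ suc ∣ Lset u ∣
  halves {u = u} {w = w} bal p with desc-split D p
  ... | v , p₁ , p₂ = begin
    2 * suc ∣ Lset w ∣     ≡⟨ *-suc 2 ∣ Lset w ∣ ⟩
    2 + 2 * ∣ Lset w ∣     ≤⟨ s≤s (3x<2y⇒3y<2z⇒2x<z (∣ Lset w ∣) (∣ Lset v ∣) (∣ Lset u ∣)
                                     (shrinks (bal _ _ p₁) p₂) (shrinks (bal 0 _ here) p₁)) ⟩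
    suc ∣ Lset u ∣         ∎
    where open ≤-Reasoning

  halvings : Everywhere (Balanced D) u → ∀ n → Desc (n * (D + D)) u v → 2 ^ n ≤ suc ∣ Lset u ∣
  halvings bal zero    _ = s≤s z≤n
  halvings {u = u} bal (suc n) p with desc-split (D + D) p
  ... | w , p₁ , p₂ = begin
    2 * 2 ^ n          ≤⟨ *-monoʳ-≤ 2 (halvings (Everywhere-desc bal p₁) n p₂) ⟩
    2 * suc ∣ Lset w ∣ ≤⟨ halves bal p₁ ⟩
    suc ∣ Lset u ∣     ∎
    where open ≤-Reasoning

  depth-<-log-Lset : Everywhere (Balanced D) u → Desc h u s → h < suc ⌊log₂ suc ∣ Lset u ∣ ⌋ * (D + D)
  depth-<-log-Lset {u = u} bal p = ≰⇒> λ long →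
    let _ , q = desc-truncate long p in n≮n ℓ (2^n≤m⇒n≤⌊log₂m⌋ (halvings bal (suc ℓ) q))
    where ℓ = ⌊log₂ suc ∣ Lset u ∣ ⌋

height-≤-log-size : ∀ G (T : RTree (nE G)) {D} → IsRSBD G T → EverywhereBelow (Balanced D) T →
                    height T ≤ 3 * (D + D) * ⌊log₂ size G ⌋
height-≤-log-size G T {D} rsbd balanced = depth-≤ (proj₂ (deepest T))
  where
  L = ⌊log₂ size G ⌋
  E = D + D

  depth-≤ : ∀ {h s} → Desc h T s → h ≤ 3 * E * L
  depth-≤ here                  = z≤n
  depth-≤ (there {c = c} c∈ p) = begin
    suc _                          ≤⟨ depth-<-log-Lset (Everywhere-children balanced c∈) p ⟩
    suc ⌊log₂ suc ∣ Lset c ∣ ⌋ * E ≤⟨ *-monoˡ-≤ E (s≤s log-child≤1+L) ⟩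
    (2 + L) * E                    ≤⟨ *-monoˡ-≤ E 2+L≤3L ⟩
    3 * L * E                      ≡⟨ xy∙z≈xz∙y 3 L E ⟩
    3 * E * L                      ∎
    where
    open ≤-Reasoning
    n = nE G
    n≥2 : 2 ≤ n
    n≥2 = root-child⇒2≤nE {G} {T} rsbd c∈
    n≤size : n ≤ size G
    n≤size = edges≤size G
    instance
      size≢0 : NonZero (size G)
      size≢0 = >-nonZero (≤-trans (s≤s z≤n) (≤-trans n≥2 n≤size))
    2+L≤3L : 2 + L ≤ 3 * L
    2+L≤3L = subst (_≤ 3 * L) (+-comm L 2)
               (+-monoʳ-≤ L (*-monoʳ-≤ 2 (2^n≤m⇒n≤⌊log₂m⌋ {1} (≤-trans n≥2 n≤size))))
    log-child≤1+L : ⌊log₂ suc ∣ Lset c ∣ ⌋ ≤ 1 + L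
    log-child≤1+L = begin
      ⌊log₂ suc ∣ Lset c ∣ ⌋ ≤⟨ ⌊log₂⌋-mono-≤ (begin
        suc ∣ Lset c ∣        ≤⟨ s≤s (∣p∣≤n (Lset c)) ⟩
        1 + n                 ≤⟨ +-monoˡ-≤ n (<⇒≤ n≥2) ⟩
        n + n                 ≤⟨ +-mono-≤ n≤size n≤size ⟩
        size G + size G       ≡⟨ cong (size G +_) (+-identityʳ (size G)) ⟨
        2 * size G            ∎) ⟩
      ⌊log₂ (2 * size G) ⌋   ≡⟨ ⌊log₂[2*b]⌋≡1+⌊log₂b⌋ (size G) ⟩
      1 + L                  ∎

3*[2^[2k+1]+2^[2k+1]]≤2^[4[k+1]] : ∀ k → 3 * (2 ^ (2 * k + 1) + 2 ^ (2 * k + 1)) ≤ 2 ^ (4 * (k + 1))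
3*[2^[2k+1]+2^[2k+1]]≤2^[4[k+1]] k = begin
  3 * (D + D)           ≤⟨ *-monoˡ-≤ (D + D) (n≤1+n 3) ⟩
  4 * (D + D)           ≡⟨ 4*[x+x]≡8*x D ⟩
  2 ^ 3 * D             ≡⟨ ^-distribˡ-+-* 2 3 (2 * k + 1) ⟨
  2 ^ (3 + (2 * k + 1)) ≤⟨ ^-monoʳ-≤ 2 {3 + (2 * k + 1)}
                             (subst (3 + (2 * k + 1) ≤_) (exponent k) (m≤m+n (3 + (2 * k + 1)) (2 * k))) ⟩
  2 ^ (4 * (k + 1))     ∎
  where
  open ≤-Reasoning
  D = 2 ^ (2 * k + 1)
  4*[x+x]≡8*x : ∀ x → 4 * (x + x) ≡ 8 * x
  4*[x+x]≡8*x = solve-∀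
  exponent : ∀ j → 3 + (2 * j + 1) + 2 * j ≡ 4 * (j + 1)
  exponent = solve-∀

lemma6p2 : Σ ℕ λ c → (G : Hypergraph) (k : ℕ) (T : RTree (nE G)) →
    IsRSBD G T → Good G k T →
    height T ≤ 2 ^ (c * (k + 1)) * ⌊log₂ size G ⌋
lemma6p2 = 4 , λ G k T rsbd good →
  ≤-trans (height-≤-log-size G T rsbd (proj₂ good))
          (*-monoˡ-≤ ⌊log₂ size G ⌋ (3*[2^[2k+1]+2^[2k+1]]≤2^[4[k+1]] k))
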